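{- Let $d\ge 2$ be a constant, $k$ a positive integer, and $\mathcal{H}$ a $d$-uniform hypergraph that has a hitting set of size at most $k$. Let $\mathcal{F}_s$ be the set of hyperedges of $\mathcal{H}$ that do not contain any large core as a subset. Then $|\mathcal{F}_s|\le d!\,(10dk)^d$.
   Context: A hitting set is a vertex set intersecting every hyperedge. A family $\{F_1,\dots,F_t\}$ of hyperedges of $\mathcal{H}$ is a $t$-sunflower with core $C\subseteq U(\mathcal{H})$ if $F_i\cap F_j=C$ for all $1\le i<j\le t$. For $C\subseteq U(\mathcal{H})$, $S_{\mathcal{H}}(C)$ denotes the maximum integer $t$ such that $C$ is the core of a $t$-sunflower in $\mathcal{H}$; $C$ is a large core if $S_{\mathcal{H}}(C)>10dk$. -}

module Defs where

open import Data.Nat using (ℕ; _≤_; _<_; _*_)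
open import Data.Fin using (Fin; _<_)
open import Data.Fin.Subset using (Subset; _∩_; ∣_∣; Nonempty; _⊆_)
open import Data.List using (List)
open import Data.List.Membership.Propositional using (_∈_)
open import Data.List.Relation.Unary.Unique.Propositional using (Unique)
open import Data.Product using (Σ; _×_; ∃)
open import Function.Definitions using (Injective)
open import Relation.Binary.PropositionalEquality using (_≡_)

record Hypergraph (n : ℕ) : Set where
  constructor mkHG
  field
    edges  : List (Subset n)
    unique : Unique edges
open Hypergraph public

Uniform : ∀ {n} → ℕ → Hypergraph n → Set
Uniform d H = ∀ {e} → e ∈ edges H → ∣ e ∣ ≡ d

IsHittingSet : ∀ {n} → Hypergraph n → Subset n → Set
IsHittingSet H S = ∀ {e} → e ∈ edges H → Nonempty (S ∩ e)

IsSunflower : ∀ {n} → Hypergraph n → (t : ℕ) → (Fin t → Subset n) → Subset n → Set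
IsSunflower H t F C =
  Injective _≡_ _≡_ F ×
  (∀ i → F i ∈ edges H) ×
  (∀ i j → i Data.Fin.< j → F i ∩ F j ≡ C)

HasSunflower : ∀ {n} → Hypergraph n → ℕ → Subset n → Set
HasSunflower H t C = Σ (Fin t → Subset _) λ F → IsSunflower H t F C

-- C is a large core: S_H(C) > 10dk, i.e. C is the core of a t-sunflower
-- for some t > 10dk (equivalent to the maximum exceeding 10dk).
IsLargeCore : ∀ {n} → Hypergraph n → (d k : ℕ) → Subset n → Set
IsLargeCore H d k C = ∃ λ t → (10 * d * k Data.Nat.< t) × HasSunflower H t C

InFs : ∀ {n} → Hypergraph n → (d k : ℕ) → Subset n → Set
InFs H d k e = e ∈ edges H × (∀ C → C ⊆ e → IsLargeCore H d k C → Data.Empty.⊥)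
  where import Data.Empty

-- Write m = 10dk and let F_s be the hyperedges of the d-uniform hypergraph H
-- containing no large core.  We prove, by induction on j, the stronger claim:
-- if C is a vertex set with d ≤ |C| + j, then at most j! m^j edges of F_s
-- contain C.  For C = ∅ and j = d this is the theorem.
--   * If |C| ≥ d, an edge containing C equals C, so there is at most one.
--   * Otherwise every such edge has a vertex outside C.  Greedily choose a
--     maximal family G of these edges pairwise meeting exactly in C.  G is a
--     sunflower with core C lying inside the edges of F_s, so |G| ≤ m.  By
--     maximality every edge through C meets some petal g ∈ G outside C, i.e.
--     contains one of the at most m(j+1) vertices of g ─ C (g ∈ G).  Each such
--     vertex x enlarges the core to C ∪ {x}, and the induction hypothesis
--     bounds the edges through C ∪ {x} by j! m^j; a union bound finishes.
module Submission where

open import Data.Nat using (ℕ; zero; suc; _≤_; _<_; _>_; z<s; >-nonZero; >-nonZero⁻¹; _*_; _^_; _!; _+_; z≤n; s≤s; _≤?_)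
open import Data.Nat.Properties
open import Data.Nat.ListAction using (sum)
open import Data.Nat.Solver using (module +-*-Solver)
open import Data.Fin using (Fin) renaming (zero to fzero; suc to fsuc; _<_ to _<ᶠ_)
import Data.Fin.Properties as FinP
open import Data.Fin.Subset using (Subset; ∣_∣; _∩_; _∪_; _─_; ⁅_⁆; _⊆_; inside; outside)
  renaming (_∈_ to _∈ˢ_; _∉_ to _∉ˢ_; ⊥ to ∅)
import Data.Fin.Subset.Properties as SubsetP
open import Data.Vec using ([]; _∷_; here; there)
open import Data.List using (List; []; _∷_; length; filter; map; concatMap; lookup)
open import Data.List.Properties using (length-map; length-++; filter-accept)
open import Data.List.Relation.Unary.All as All using (All; []; _∷_)
import Data.List.Relation.Unary.All.Properties as AllP
open import Data.List.Relation.Unary.Any as Any using (Any; here; there)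
open import Data.List.Relation.Unary.AllPairs using (AllPairs; []; _∷_)
open import Data.List.Relation.Unary.Unique.Propositional using (Unique)
import Data.List.Relation.Unary.Unique.Propositional.Properties as UniqueP
open import Data.List.Membership.Propositional using (_∈_; lose; find)
open import Data.List.Membership.Propositional.Properties
  using (∈-map⁺; ∈-map⁻; ∈-lookup; ∈-concatMap⁺; ∈-concatMap⁻)
open import Data.Product using (Σ; ∃; _×_; _,_; proj₁; proj₂)
open import Data.Sum using (_⊎_; inj₁; inj₂)
open import Data.Empty using (⊥-elim)
open import Function using (_∘_)
open import Function.Definitions using (Injective)
open import Relation.Binary.Definitions using (tri<; tri≈; tri>)
open import Relation.Nullary using (Dec; yes; no; ¬_)
open import Relation.Nullary.Decidable using (_×-dec_; ¬?)
open import Relation.Binary.PropositionalEquality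
open import Defs

sum-map-mono-≤ : {A : Set} {f g : A → ℕ} → (∀ x → f x ≤ g x) →
  (xs : List A) → sum (map f xs) ≤ sum (map g xs)
sum-map-mono-≤ f≤g []       = z≤n
sum-map-mono-≤ f≤g (x ∷ xs) = +-mono-≤ (f≤g x) (sum-map-mono-≤ f≤g xs)

sum-map-mono-< : {A : Set} {f g : A → ℕ} → (∀ x → f x ≤ g x) →
  {xs : List A} → Any (λ x → f x < g x) xs → sum (map f xs) < sum (map g xs)
sum-map-mono-< f≤g {x ∷ xs} (here fx<gx) = +-mono-<-≤ fx<gx (sum-map-mono-≤ f≤g xs)
sum-map-mono-< f≤g {x ∷ xs} (there any)  = +-mono-≤-< (f≤g x) (sum-map-mono-< f≤g any)

sum-map-≤-* : {A : Set} {f : A → ℕ} (b : ℕ) {xs : List A} →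
  All (λ x → f x ≤ b) xs → sum (map f xs) ≤ length xs * b
sum-map-≤-* b []            = z≤n
sum-map-≤-* b (fx≤b ∷ f≤b) = +-mono-≤ fx≤b (sum-map-≤-* b f≤b)

length-concatMap-≤ : {A B : Set} {f : A → List B} (b : ℕ) {xs : List A} →
  All (λ x → length (f x) ≤ b) xs → length (concatMap f xs) ≤ length xs * b
length-concatMap-≤ {f = f} b {x ∷ xs} (fx≤b ∷ f≤b) =
  subst (_≤ b + length xs * b) (sym (length-++ (f x)))
        (+-mono-≤ fx≤b (length-concatMap-≤ b f≤b))
length-concatMap-≤ b {[]} [] = z≤n

union-bound : {A B : Set} (P : A → B → Set) (P? : ∀ x e → Dec (P x e))
  (xs : List A) (L : List B) → All (λ e → Any (λ x → P x e) xs) L →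
  length L ≤ sum (map (λ x → length (filter (P? x) L)) xs)
union-bound P P? xs []      []               = z≤n
union-bound P P? xs (e ∷ L) (hit-e ∷ hit-L) =
  ≤-trans (s≤s (union-bound P P? xs L hit-L))
          (sum-map-mono-< one-more (Any.map counted hit-e))
  where
  one-more : ∀ x → length (filter (P? x) L) ≤ length (filter (P? x) (e ∷ L))
  one-more x with P? x e
  ... | yes _ = n≤1+n _
  ... | no _  = ≤-refl
  counted : ∀ {x} → P x e → length (filter (P? x) L) < length (filter (P? x) (e ∷ L))
  counted {x} pxe rewrite filter-accept (P? x) {e} {L} pxe = ≤-refl

pairwise-lookup : {A : Set} {R : A → A → Set} {xs : List A} → AllPairs R xs →
  {i j : Fin (length xs)} → i <ᶠ j → R (lookup xs i) (lookup xs j)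
pairwise-lookup (r ∷ _)  {fzero}  {fsuc j} _         = All.lookup r (∈-lookup j)
pairwise-lookup (_ ∷ rs) {fsuc i} {fsuc j} (s≤s i<j) = pairwise-lookup rs i<j

-- Let B e g mean "e is blocked by g", where every
-- candidate blocks itself and unblocked candidates are R-related.  Then the
-- candidates L contain a pairwise R-related family G blocking every e ∈ L.
maximal-family : {A : Set} {P : A → Set} (B R : A → A → Set) →
  (∀ e g → Dec (B e g)) → (∀ {e} → P e → B e e) →
  (∀ {e g} → P e → P g → ¬ B e g → R e g) →
  (L : List A) → All P L →
  Σ (List A) λ G → All P G × AllPairs R G × All (λ e → Any (B e) G) L
maximal-family B R B? B-refl unblocked⇒R [] [] = [] , [] , [] , []
maximal-family B R B? B-refl unblocked⇒R (e ∷ L) (pe ∷ pL)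
  with maximal-family B R B? B-refl unblocked⇒R L pL
... | G , pG , rG , blocked with Any.any? (B? e) G
...   | yes e-blocked = G , pG , rG , e-blocked ∷ blocked
...   | no e-free =
  e ∷ G , pe ∷ pG ,
  All.tabulate (λ g∈G → unblocked⇒R pe (All.lookup pG g∈G) (e-free ∘ lose g∈G)) ∷ rG ,
  here (B-refl pe) ∷ All.map there blocked

elements : ∀ {n} → Subset n → List (Fin n)
elements []            = []
elements (inside ∷ p)  = fzero ∷ map fsuc (elements p)
elements (outside ∷ p) = map fsuc (elements p)

length-elements : ∀ {n} (p : Subset n) → length (elements p) ≡ ∣ p ∣
length-elements []            = refl
length-elements (inside ∷ p)  = cong suc (trans (length-map fsuc (elements p)) (length-elements p))
length-elements (outside ∷ p) = trans (length-map fsuc (elements p)) (length-elements p)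

∈-elements⁺ : ∀ {n} {p : Subset n} {x} → x ∈ˢ p → x ∈ elements p
∈-elements⁺ {p = inside ∷ p}  here        = here refl
∈-elements⁺ {p = inside ∷ p}  (there x∈p) = there (∈-map⁺ fsuc (∈-elements⁺ x∈p))
∈-elements⁺ {p = outside ∷ p} (there x∈p) = ∈-map⁺ fsuc (∈-elements⁺ x∈p)

∈-elements⁻ : ∀ {n} (p : Subset n) {x} → x ∈ elements p → x ∈ˢ p
∈-elements⁻ (inside ∷ p) (here refl) = here
∈-elements⁻ (inside ∷ p) (there x∈) with ∈-map⁻ fsuc x∈
... | y , y∈ , refl = there (∈-elements⁻ p y∈)
∈-elements⁻ (outside ∷ p) x∈ with ∈-map⁻ fsuc x∈
... | y , y∈ , refl = there (∈-elements⁻ p y∈)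

∉-─ : ∀ {n} (p q : Subset n) {x} → x ∈ˢ p ─ q → x ∉ˢ q
∉-─ (s ∷ p) (outside ∷ q) (there x∈) (there x∈q) = ∉-─ p q x∈ x∈q
∉-─ (s ∷ p) (inside ∷ q)  (there x∈) (there x∈q) = ∉-─ p q x∈ x∈q

∣p─q∣+∣q∣≡∣p∣ : ∀ {n} (p q : Subset n) → q ⊆ p → ∣ p ─ q ∣ + ∣ q ∣ ≡ ∣ p ∣
∣p─q∣+∣q∣≡∣p∣ []            []            _   = refl
∣p─q∣+∣q∣≡∣p∣ (inside ∷ p)  (outside ∷ q) q⊆p = cong suc (∣p─q∣+∣q∣≡∣p∣ p q (SubsetP.drop-∷-⊆ q⊆p))
∣p─q∣+∣q∣≡∣p∣ (inside ∷ p)  (inside ∷ q)  q⊆p =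
  trans (+-suc _ _) (cong suc (∣p─q∣+∣q∣≡∣p∣ p q (SubsetP.drop-∷-⊆ q⊆p)))
∣p─q∣+∣q∣≡∣p∣ (outside ∷ p) (outside ∷ q) q⊆p = ∣p─q∣+∣q∣≡∣p∣ p q (SubsetP.drop-∷-⊆ q⊆p)
∣p─q∣+∣q∣≡∣p∣ (outside ∷ p) (inside ∷ q)  q⊆p with q⊆p here
... | ()

⊆-or-outside : ∀ {n} (C e : Subset n) → e ⊆ C ⊎ ∃ λ x → x ∈ˢ e × x ∉ˢ C
⊆-or-outside C e with FinP.any? (λ x → (x SubsetP.∈? e) ×-dec ¬? (x SubsetP.∈? C))
... | yes escape = inj₂ escape
... | no none = inj₁ e⊆C
  where
  e⊆C : e ⊆ C
  e⊆C {x} x∈e with x SubsetP.∈? C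
  ... | yes x∈C = x∈C
  ... | no x∉C  = ⊥-elim (none (x , x∈e , x∉C))

⊇-∣∣-≤⇒≡ : ∀ {n} {C e : Subset n} → C ⊆ e → ∣ e ∣ ≤ ∣ C ∣ → e ≡ C
⊇-∣∣-≤⇒≡ {C = C} {e} C⊆e ∣e∣≤∣C∣ with ⊆-or-outside C e
... | inj₁ e⊆C = SubsetP.⊆-antisym e⊆C C⊆e
... | inj₂ escape  = ⊥-elim (<⇒≱ (SubsetP.p⊂q⇒∣p∣<∣q∣ (C⊆e , escape)) ∣e∣≤∣C∣)

⊇-∣∣->⇒outside : ∀ {n} {C e : Subset n} → C ⊆ e → ∣ C ∣ < ∣ e ∣ → ∃ λ x → x ∈ˢ e × x ∉ˢ C
⊇-∣∣->⇒outside {C = C} {e} C⊆e ∣C∣<∣e∣ with ⊆-or-outside C e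
... | inj₁ e⊆C    = ⊥-elim (<⇒≱ ∣C∣<∣e∣ (SubsetP.p⊆q⇒∣p∣≤∣q∣ e⊆C))
... | inj₂ escape  = escape

∣∪⁅x⁆∣ : ∀ {n} (C : Subset n) {x} → x ∉ˢ C → suc ∣ C ∣ ≤ ∣ C ∪ ⁅ x ⁆ ∣
∣∪⁅x⁆∣ C {x} x∉C =
  SubsetP.p⊂q⇒∣p∣<∣q∣ (SubsetP.p⊆p∪q ⁅ x ⁆ , x , SubsetP.q⊆p∪q C ⁅ x ⁆ (SubsetP.x∈⁅x⁆ x) , x∉C)

all-≡-unique : {A : Set} (C : A) (L : List A) → Unique L → All (_≡ C) L → length L ≤ 1
all-≡-unique C []          _                   _                  = z≤n
all-≡-unique C (e ∷ [])    _                   _                  = ≤-refl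
all-≡-unique C (e ∷ e′ ∷ L) ((e≢e′ ∷ _) ∷ _) (e≡C ∷ e′≡C ∷ _) = ⊥-elim (e≢e′ (trans e≡C (sym e′≡C)))

module Cores {n : ℕ} (H : Hypergraph n) (d k : ℕ) (uniform : Uniform d H) where

  m : ℕ
  m = 10 * d * k

  Through : Subset n → Subset n → Set
  Through C e = InFs H d k e × C ⊆ e

  Petals : Subset n → Subset n → Subset n → Set
  Petals C e g = e ≢ g × e ∩ g ≡ C

  MeetOutside : Subset n → Subset n → Subset n → Set
  MeetOutside C e g = ∃ λ x → x ∈ˢ e × x ∈ˢ g × x ∉ˢ C

  meetOutside? : ∀ C e g → Dec (MeetOutside C e g)
  meetOutside? C e g =
    FinP.any? (λ x → (x SubsetP.∈? e) ×-dec ((x SubsetP.∈? g) ×-dec ¬? (x SubsetP.∈? C)))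

  disjoint⇒petals : ∀ {C e g} → Through C e × (∃ λ x → x ∈ˢ e × x ∉ˢ C) → Through C g →
    ¬ MeetOutside C e g → Petals C e g
  disjoint⇒petals {C} {e} {g} ((_ , C⊆e) , x , x∈e , x∉C) (_ , C⊆g) disjoint =
    (λ { refl → disjoint (x , x∈e , x∈e , x∉C) }) , SubsetP.⊆-antisym e∩g⊆C C⊆e∩g
    where
    e∩g⊆C : e ∩ g ⊆ C
    e∩g⊆C {y} y∈e∩g with y SubsetP.∈? C
    ... | yes y∈C = y∈C
    ... | no y∉C  = let (y∈e , y∈g) = SubsetP.x∈p∩q⁻ e g y∈e∩g in
                    ⊥-elim (disjoint (y , y∈e , y∈g , y∉C))
    C⊆e∩g : C ⊆ e ∩ g
    C⊆e∩g y∈C = SubsetP.x∈p∩q⁺ (C⊆e y∈C , C⊆g y∈C)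

  sunflower : ∀ {C} (G : List (Subset n)) → AllPairs (Petals C) G → All (_∈ edges H) G →
    HasSunflower H (length G) C
  sunflower G petals inH = lookup G , injective , (λ i → All.lookup inH (∈-lookup i)) ,
    (λ i j i<j → proj₂ (pairwise-lookup petals i<j))
    where
    injective : Injective _≡_ _≡_ (lookup G)
    injective {i} {j} eq with FinP.<-cmp i j
    ... | tri< i<j _ _ = ⊥-elim (proj₁ (pairwise-lookup petals i<j) eq)
    ... | tri≈ _ i≡j _ = i≡j
    ... | tri> _ _ j<i = ⊥-elim (proj₁ (pairwise-lookup petals j<i) (sym eq))

  -- Since C lies in an edge of F_s, it is no large core, so a petal family
  -- of edges through C has at most m members.
  petals-≤-m : ∀ {C} (G : List (Subset n)) → AllPairs (Petals C) G → All (Through C) G →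
    length G ≤ m
  petals-≤-m [] _ _ = z≤n
  petals-≤-m {C} G@(_ ∷ _) petals through@(((_ , noLargeCore) , C⊆g) ∷ _) with length G ≤? m
  ... | yes |G|≤m = |G|≤m
  ... | no |G|≰m  = ⊥-elim (noLargeCore C C⊆g (length G , ≰⇒> |G|≰m ,
    sunflower G petals (All.map (proj₁ ∘ proj₁) through)))

  outside-vertex : ∀ {C e} → ∣ C ∣ < d → Through C e → ∃ λ x → x ∈ˢ e × x ∉ˢ C
  outside-vertex {C} ∣C∣<d ((e∈H , _) , C⊆e) =
    ⊇-∣∣->⇒outside C⊆e (subst (∣ C ∣ <_) (sym (uniform e∈H)) ∣C∣<d)

  covering-petals : ∀ {C} → ∣ C ∣ < d → (L : List (Subset n)) → All (Through C) L →
    Σ (List (Subset n)) λ G → length G ≤ m × All (Through C) G ×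
      All (λ e → Any (MeetOutside C e) G) L
  covering-petals {C} ∣C∣<d L through
    with maximal-family (MeetOutside C) (Petals C) (meetOutside? C)
           (λ { (_ , x , x∈e , x∉C) → x , x∈e , x∈e , x∉C })
           (λ pe pg → disjoint⇒petals pe (proj₁ pg))
           L (All.map (λ th → th , outside-vertex ∣C∣<d th) through)
  ... | G , pG , petals , meet =
    G , petals-≤-m G petals (All.map proj₁ pG) , All.map proj₁ pG , meet

  newVertices : Subset n → List (Subset n) → List (Fin n)
  newVertices C = concatMap (λ g → elements (g ─ C))

  newVertex-∉ : ∀ {C} G {x} → x ∈ newVertices C G → x ∉ˢ C
  newVertex-∉ {C} G x∈ with find (∈-concatMap⁻ (λ g → elements (g ─ C)) {G} x∈)
  ... | g , _ , x∈g─C = ∉-─ g C (∈-elements⁻ (g ─ C) x∈g─C)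

  meet⇒newVertex : ∀ {C e} G → Any (MeetOutside C e) G → Any (_∈ˢ e) (newVertices C G)
  meet⇒newVertex {C} G meet with find meet
  ... | g , g∈G , x , x∈e , x∈g , x∉C =
    lose (∈-concatMap⁺ (λ g → elements (g ─ C)) {G}
           (lose g∈G (∈-elements⁺ (SubsetP.x∈p∧x∉q⇒x∈p─q x∈g x∉C)))) x∈e

  -- Each edge through C has at most d − |C| ≤ j + 1 vertices outside C.
  newVertices-length : ∀ {C} j G → d ≤ ∣ C ∣ + suc j → All (Through C) G →
    length (newVertices C G) ≤ length G * suc j
  newVertices-length {C} j G d≤ through = length-concatMap-≤ (suc j) (All.map bound through)
    where
    bound : ∀ {g} → Through C g → length (elements (g ─ C)) ≤ suc j
    bound {g} ((g∈H , _) , C⊆g) = +-cancelʳ-≤ ∣ C ∣ _ _ (begin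
      length (elements (g ─ C)) + ∣ C ∣ ≡⟨ cong (_+ ∣ C ∣) (length-elements (g ─ C)) ⟩
      ∣ g ─ C ∣ + ∣ C ∣                  ≡⟨ ∣p─q∣+∣q∣≡∣p∣ g C C⊆g ⟩
      ∣ g ∣                              ≡⟨ uniform g∈H ⟩
      d                                  ≤⟨ d≤ ⟩
      ∣ C ∣ + suc j                      ≡⟨ +-comm ∣ C ∣ (suc j) ⟩
      suc j + ∣ C ∣                      ∎)
      where open ≤-Reasoning

  -- Edges through a core of size at least d equal the core: at most one.
  full-core : ∀ {C} (L : List (Subset n)) → Unique L → All (Through C) L → d ≤ ∣ C ∣ →
    length L ≤ 1
  full-core {C} L unique through d≤∣C∣ = all-≡-unique C L unique (All.map equal through)
    where
    equal : ∀ {e} → Through C e → e ≡ C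
    equal ((e∈H , _) , C⊆e) = ⊇-∣∣-≤⇒≡ C⊆e (subst (_≤ ∣ C ∣) (sym (uniform e∈H)) d≤∣C∣)

  through-∪⁅x⁆ : ∀ {C x e} → Through C e × x ∈ˢ e → Through (C ∪ ⁅ x ⁆) e
  through-∪⁅x⁆ {C} {x} {e} ((inFs , C⊆e) , x∈e) = inFs , C∪x⊆e
    where
    C∪x⊆e : C ∪ ⁅ x ⁆ ⊆ e
    C∪x⊆e y∈ with SubsetP.x∈p∪q⁻ C ⁅ x ⁆ y∈
    ... | inj₁ y∈C = C⊆e y∈C
    ... | inj₂ y∈x = subst (_∈ˢ e) (sym (SubsetP.x∈⁅y⁆⇒x≡y x y∈x)) x∈e

  rearrange : ∀ j → m * suc j * (j ! * m ^ j) ≡ suc j ! * m ^ suc j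
  rearrange j = solve 4 (λ m j′ f p → m :* j′ :* (f :* p) := j′ :* f :* (m :* p))
                        refl m (suc j) (j !) (m ^ j)
    where open +-*-Solver using (solve; _:*_; _:=_)

  through-bound : m > 0 → ∀ j {C} (L : List (Subset n)) → Unique L → All (Through C) L →
    d ≤ ∣ C ∣ + j → length L ≤ j ! * m ^ j
  through-bound m>0 j {C} L unique through d≤ with d ≤? ∣ C ∣
  ... | yes d≤∣C∣ = ≤-trans (full-core L unique through d≤∣C∣)
    (*-mono-≤ (>-nonZero⁻¹ (j !) {{j !≢0}}) (m^n>0 m {{>-nonZero m>0}} j))
  through-bound m>0 zero {C} L _ _ d≤ | no d≰∣C∣ =
    ⊥-elim (d≰∣C∣ (subst (d ≤_) (+-identityʳ ∣ C ∣) d≤))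
  through-bound m>0 (suc j) {C} L unique through d≤ | no d≰∣C∣
    with covering-petals (≰⇒> d≰∣C∣) L through
  ... | G , |G|≤m , throughG , meet = begin
    length L            ≤⟨ union-bound _∈ˢ_ SubsetP._∈?_ xs L (All.map (meet⇒newVertex G) meet) ⟩
    sum (map count xs)  ≤⟨ sum-map-≤-* B (All.tabulate through-new-vertex) ⟩
    length xs * B       ≤⟨ *-monoˡ-≤ B |xs|≤ ⟩
    m * suc j * B       ≡⟨ rearrange j ⟩
    suc j ! * m ^ suc j ∎
    where
    open ≤-Reasoning
    xs = newVertices C G
    B  = j ! * m ^ j
    count : Fin n → ℕ
    count x = length (filter (SubsetP._∈?_ x) L)
    |xs|≤ : length xs ≤ m * suc j
    |xs|≤ = ≤-trans (newVertices-length j G d≤ throughG) (*-monoˡ-≤ (suc j) |G|≤m)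
    -- Each new vertex x enlarges the core, so the induction hypothesis applies.
    through-new-vertex : ∀ {x} → x ∈ xs → count x ≤ B
    through-new-vertex {x} x∈xs = through-bound m>0 j (filter (SubsetP._∈?_ x) L)
      (UniqueP.filter⁺ (SubsetP._∈?_ x) unique)
      (All.map through-∪⁅x⁆ (All.zip (AllP.filter⁺ (SubsetP._∈?_ x) through ,
                                        AllP.all-filter (SubsetP._∈?_ x) L)))
      (begin d                   ≤⟨ d≤ ⟩
             ∣ C ∣ + suc j        ≡⟨ +-suc ∣ C ∣ j ⟩
             suc ∣ C ∣ + j        ≤⟨ +-monoˡ-≤ j (∣∪⁅x⁆∣ C (newVertex-∉ G x∈xs)) ⟩
             ∣ C ∪ ⁅ x ⁆ ∣ + j    ∎)

-- The theorem: the main claim for the empty core and j = d (here m > 0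
-- because d, k ≥ 1).
lemma7 : (n d k : ℕ) → 2 ≤ d → 1 ≤ k → (H : Hypergraph n) → Uniform d H →
    Σ (Subset n) (λ S → IsHittingSet H S × ∣ S ∣ ≤ k) →
    (Fs : List (Subset n)) → Unique Fs → All (InFs H d k) Fs →
    length Fs ≤ (d !) * (10 * d * k) ^ d
lemma7 n d@(suc (suc _)) k@(suc _) (s≤s (s≤s _)) (s≤s _) H uniform _ Fs unique inFs =
  Cores.through-bound H d k uniform z<s d {∅} Fs unique
    (All.map (λ e∈Fs → e∈Fs , λ {_} x∈∅ → SubsetP.⊥⊆ x∈∅) inFs)
    (subst (λ s → d ≤ s + d) (sym (SubsetP.∣⊥∣≡0 n)) ≤-refl)
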